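{- Let $A$ be the well-formed environment $\{\!\{e_1,nl_1,ol_1,\{\!\{e_2,nl_2,ol_3,e_3\}\!\}\}\!\}$ where $e_3$ is a simple environment and $e_2$ has the form $(t_2,n_2)::e_2'$. Let $i$ be a positive integer with $i\le nl_2-n_2$ and $i\le ol_3$, and let $B$ be the environment $\{\!\{e_1,nl_1,ol_1,\{\!\{e_2,nl_2-i,ol_3-i,e_3\{i\}\}\!\}\}\!\}$. If $A\rhd_{rm}^* C$ for a simple environment $C$, then also $B \rhd_{rm}^* C$.
   Context: Suspension calculus with meta variables. Terms $t ::= c \mid v \mid \#i \mid (t\ t)\mid(\lambda\, t)\mid [\![t,n,n,e]\!]$, environments $e::= nil\mid ((t,n)::e)\mid \{\!\{e,n,n,e\}\!\}$ ($c$ constants, $v$ meta variables, $n$ naturals, $i$ positive integers). $m\mathbin{\dot- } n=\max(m-n,0)$. Length: $len(nil)=0$, $len((t,l)::e)=1+len(e)$, $len(\{\!\{e_1,nl_1,ol_2,e_2\}\!\})=len(e_1)+(len(e_2)\mathbin{\dot- } nl_1)$. Level: $lev(nil)=0$, $lev((t,l)::e)=l$, $lev(\{\!\{e_1,nl_1,ol_2,e_2\}\!\})=lev(e_2)+(nl_1\mathbin{\dot- } ol_2)$. Well-formed: every subexpression satisfies: $[\![t,ol,nl,e]\!]$ has $len(e)=ol$, $lev(e)\le nl$; $(t,l)::e$ has $l\ge lev(e)$; $\{\!\{e_1,nl_1,ol_2,e_2\}\!\}$ has $lev(e_1)\le nl_1$, $len(e_2)=ol_2$. Only well-formed expressions are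 considered. A simple environment is one of the form $(t_0,l_0)::\cdots::(t_{k-1},l_{k-1})::nil$ ($k\ge0$); for such $e$, $e\{i\}$ denotes $(t_i,l_i)::\cdots::(t_{k-1},l_{k-1})::nil$ (the result of removing the first $i$ elements), and $nil$ if $i\ge k$. Reading rules: (r1) $[\![c,ol,nl,e]\!]\to c$; (r2) $[\![\#i,0,nl,nil]\!]\to\#(i+nl)$; (r3) $[\![\#1,ol,nl,(t,l)::e]\!]\to[\![t,0,nl-l,nil]\!]$; (r4) $[\![\#i,ol,nl,(t,l)::e]\!]\to[\![\#(i-1),ol-1,nl,e]\!]$ if $i>1$; (r5) $[\![(t_1\ t_2),ol,nl,e]\!]\to([\![t_1,ol,nl,e]\!]\ [\![t_2,ol,nl,e]\!])$; (r6) $[\![(\lambda t),ol,nl,e]\!]\to(\lambda [\![t,ol+1,nl+1,(\#1,nl+1)::e]\!])$. Merging rules: (m1) $[\![[\![t,ol_1,nl_1,e_1]\!],ol_2,nl_2,e_2]\!]\to[\![t,ol_1+(ol_2\mathbin{\dot- } nl_1),nl_2+(nl_1\mathbin{\dot- } ol_2),\{\!\{e_1,nl_1,ol_2,e_2\}\!\}]\!]$; (m2) $\{\!\{e_1,nl_1,0,nil\}\!\}\to e_1$; (m3) $\{\!\{nil,0,ol_2,e_2\}\!\}\to e_2$; (m4) $\{\!\{nil,nl_1,ol_2,(t,l)::e_2\}\!\}\to\{\!\{nil,nl_1-1,ol_2-1,e_2\}\!\}$ if $nl_1\ge1$; (m5) $\{\!\{(t,n)::e_1,nl_1,ol_2,(s,l)::e_2\}\!\}\to\{\!\{(t,n)::e_1,nl_1-1,ol_2-1,e_2\}\!\}$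 if $nl_1>n$; (m6) $\{\!\{(t,n)::e_1,n,ol_2,(s,l)::e_2\}\!\}\to([\![t,ol_2,l,(s,l)::e_2]\!],l+(n\mathbin{\dot- } ol_2))::\{\!\{e_1,n,ol_2,(s,l)::e_2\}\!\}$. No rule acts on meta variables. $x\rhd_{rm}y$: $y$ results from $x$ by one of these rules at some subexpression; $\rhd_{rm}^*$ is its reflexive–transitive closure. -}

module Defs where

open import Data.Nat using (ℕ; zero; suc; _+_; _∸_; _≤_; _<_)
open import Data.Product using (_×_)
open import Data.Unit using (⊤)
open import Relation.Binary.PropositionalEquality using (_≡_)
open import Relation.Binary.Construct.Closure.ReflexiveTransitive using (Star)

-- Constants and meta variables are named by natural numbers.
-- De Bruijn index #i is `var i`; positivity (1 ≤ i) is part of well-formedness.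
mutual
  data Term : Set where
    const : ℕ → Term
    meta  : ℕ → Term
    var   : ℕ → Term
    app   : Term → Term → Term
    lam   : Term → Term
    susp  : Term → ℕ → ℕ → Env → Term      -- [[t , ol , nl , e]]

  data Env : Set where
    nil   : Env
    cons  : Term → ℕ → Env → Env
    merge : Env → ℕ → ℕ → Env → Env       -- {{e1 , nl1 , ol2 , e2}}

len : Env → ℕ
len nil = 0
len (cons t l e) = suc (len e)
len (merge e₁ nl₁ ol₂ e₂) = len e₁ + (len e₂ ∸ nl₁)

lev : Env → ℕ
lev nil = 0
lev (cons t l e) = l
lev (merge e₁ nl₁ ol₂ e₂) = lev e₂ + (nl₁ ∸ ol₂)

mutual
  WFt : Term → Set
  WFt (const c) = ⊤
  WFt (meta v) = ⊤
  WFt (var i) = 1 ≤ i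
  WFt (app t₁ t₂) = WFt t₁ × WFt t₂
  WFt (lam t) = WFt t
  WFt (susp t ol nl e) = WFt t × WFe e × len e ≡ ol × lev e ≤ nl

  WFe : Env → Set
  WFe nil = ⊤
  WFe (cons t l e) = WFt t × WFe e × lev e ≤ l
  WFe (merge e₁ nl₁ ol₂ e₂) = WFe e₁ × WFe e₂ × lev e₁ ≤ nl₁ × len e₂ ≡ ol₂

data Simple : Env → Set where
  nil  : Simple nil
  cons : ∀ {t l e} → Simple e → Simple (cons t l e)

-- e{i}: remove the first i elements (only used on simple environments;
-- on a merge it is left unchanged, which is irrelevant for simple ones).
drop : ℕ → Env → Env
drop zero e = e
drop (suc i) nil = nil
drop (suc i) (cons t l e) = drop i e
drop (suc i) (merge e₁ n o e₂) = merge e₁ n o e₂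

mutual
  data _▷t_ : Term → Term → Set where
    r1 : ∀ {c ol nl e} → susp (const c) ol nl e ▷t const c
    r2 : ∀ {i nl} → susp (var i) 0 nl nil ▷t var (i + nl)
    r3 : ∀ {ol nl t l e} → susp (var 1) ol nl (cons t l e) ▷t susp t 0 (nl ∸ l) nil
    r4 : ∀ {i ol nl t l e} → 1 < i →
         susp (var i) ol nl (cons t l e) ▷t susp (var (i ∸ 1)) (ol ∸ 1) nl e
    r5 : ∀ {t₁ t₂ ol nl e} →
         susp (app t₁ t₂) ol nl e ▷t app (susp t₁ ol nl e) (susp t₂ ol nl e)
    r6 : ∀ {t ol nl e} →
         susp (lam t) ol nl e ▷t lam (susp t (suc ol) (suc nl) (cons (var 1) (suc nl) e))
    m1 : ∀ {t ol₁ nl₁ e₁ ol₂ nl₂ e₂} →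
         susp (susp t ol₁ nl₁ e₁) ol₂ nl₂ e₂ ▷t
         susp t (ol₁ + (ol₂ ∸ nl₁)) (nl₂ + (nl₁ ∸ ol₂)) (merge e₁ nl₁ ol₂ e₂)
    appˡ  : ∀ {t t' s} → t ▷t t' → app t s ▷t app t' s
    appʳ  : ∀ {t s s'} → s ▷t s' → app t s ▷t app t s'
    lamᶜ  : ∀ {t t'} → t ▷t t' → lam t ▷t lam t'
    suspᵗ : ∀ {t t' ol nl e} → t ▷t t' → susp t ol nl e ▷t susp t' ol nl e
    suspᵉ : ∀ {t ol nl e e'} → e ▷e e' → susp t ol nl e ▷t susp t ol nl e'

  data _▷e_ : Env → Env → Set where
    m2 : ∀ {e₁ nl₁} → merge e₁ nl₁ 0 nil ▷e e₁
    m3 : ∀ {ol₂ e₂} → merge nil 0 ol₂ e₂ ▷e e₂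
    m4 : ∀ {nl₁ ol₂ t l e₂} →
         merge nil (suc nl₁) ol₂ (cons t l e₂) ▷e merge nil nl₁ (ol₂ ∸ 1) e₂
    m5 : ∀ {t n e₁ nl₁ ol₂ s l e₂} → n < nl₁ →
         merge (cons t n e₁) nl₁ ol₂ (cons s l e₂) ▷e merge (cons t n e₁) (nl₁ ∸ 1) (ol₂ ∸ 1) e₂
    m6 : ∀ {t n e₁ ol₂ s l e₂} →
         merge (cons t n e₁) n ol₂ (cons s l e₂) ▷e
         cons (susp t ol₂ l (cons s l e₂)) (l + (n ∸ ol₂)) (merge e₁ n ol₂ (cons s l e₂))
    consᵗ  : ∀ {t t' l e} → t ▷t t' → cons t l e ▷e cons t' l e
    consᵉ  : ∀ {t l e e'} → e ▷e e' → cons t l e ▷e cons t l e'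
    mergeˡ : ∀ {e₁ e₁' n o e₂} → e₁ ▷e e₁' → merge e₁ n o e₂ ▷e merge e₁' n o e₂
    mergeʳ : ∀ {e₁ n o e₂ e₂'} → e₂ ▷e e₂' → merge e₁ n o e₂ ▷e merge e₁ n o e₂'

_▷e*_ : Env → Env → Set
_▷e*_ = Star _▷e_

module Submission where

-- B simulates A step by step.  As long as the inner merge of A still carries at
-- least one of the i entries of e₃ that B has skipped, every rewrite of A is matched
-- by at most one rewrite of B: an m5 step of A discards one skipped entry and is
-- matched by no step at all, m6 and m2 cannot fire because nl₂ exceeds n₂ and e₃
-- is nonempty, and a rewrite inside the simple e₃ is copied to e₃{i} unless it
-- touches a skipped entry.  Once A has discarded all i entries the two
-- environments coincide, and a simple environment is never related to a merge.

open import Defs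
open import Data.Nat using (ℕ; zero; suc; _≤_; _∸_; s≤s)
open import Data.Nat.Properties using (∸-+-assoc; n∸n≡0; pred[m∸n]≡m∸[1+n]; pred-mono-≤)
open import Data.Product using (Σ-syntax; _×_; _,_)
open import Relation.Binary.PropositionalEquality using (_≡_; refl; sym; trans; cong; subst)
open import Relation.Binary.Construct.Closure.ReflexiveTransitive
  using (Star; ε; _◅_; _◅◅_; gmap; return)

private
  variable
    t : Term
    e f f' X X' Y : Env
    j n nl ol p q : ℕ

▷e-pres-Simple : Simple f → f ▷e f' → Simple f'
▷e-pres-Simple (cons s) (consᵗ _)  = cons s
▷e-pres-Simple (cons s) (consᵉ st) = cons (▷e-pres-Simple s st)

▷e-pres-len : Simple f → f ▷e f' → len f' ≡ len f
▷e-pres-len (cons s) (consᵗ _)  = refl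
▷e-pres-len (cons s) (consᵉ st) = cong suc (▷e-pres-len s st)

drop-▷e : ∀ j → Simple f → f ▷e f' → drop j f ▷e* drop j f'
drop-▷e zero    _        st         = return st
drop-▷e (suc j) (cons s) (consᵗ _)  = ε
drop-▷e (suc j) (cons s) (consᵉ st) = drop-▷e j s st

pred-≤-∸ : ∀ p n → suc j ≤ p ∸ n → j ≤ p ∸ 1 ∸ n
pred-≤-∸ {j} p n h =
  subst (j ≤_) (trans (pred[m∸n]≡m∸[1+n] p n) (sym (∸-+-assoc p 1 n))) (pred-mono-≤ h)

data Skipped : Env → Env → Set where
  same  : Skipped X X
  skip  : ∀ {t n e p q f j} → Simple f → j ≤ p ∸ n → j ≤ len f →
          Skipped (merge (cons t n e) p q f) (merge (cons t n e) (p ∸ j) (q ∸ j) (drop j f))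
  under : Skipped X Y → Skipped (merge e nl ol X) (merge e nl ol Y)

skip-past-head : ∀ j → Simple f → suc j ≤ p ∸ n → j ≤ len f →
  Skipped (merge (cons t n e) (p ∸ 1) (q ∸ 1) f)
          (merge (cons t n e) (p ∸ suc j) (q ∸ suc j) (drop j f))
skip-past-head {p = p} {n = n} {q = q} j s h k
  rewrite sym (∸-+-assoc p 1 j) | sym (∸-+-assoc q 1 j) =
    skip {p = p ∸ 1} {q = q ∸ 1} s (pred-≤-∸ p n h) k

Skipped-simulates : Skipped X Y → X ▷e X' → Σ[ Y' ∈ Env ] (Y ▷e* Y') × Skipped X' Y'
Skipped-simulates same st = _ , return st , same
Skipped-simulates (skip {j = zero} _ _ _) st = _ , return st , same
Skipped-simulates (skip {n = n} {p = p} {q} {j = suc j} (cons s) h (s≤s k)) (m5 _) =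
  _ , ε , skip-past-head {p = p} {n = n} {q = q} j s h k
Skipped-simulates (skip {n = n} {j = suc j} _ h _) m6 with subst (suc j ≤_) (n∸n≡0 n) h
... | ()
Skipped-simulates (skip {j = suc j} _ _ ()) m2
Skipped-simulates (skip {j = suc j} s h k) (mergeˡ (consᵗ st)) =
  _ , return (mergeˡ (consᵗ st)) , skip s h k
Skipped-simulates (skip {j = suc j} s h k) (mergeˡ (consᵉ st)) =
  _ , return (mergeˡ (consᵉ st)) , skip s h k
Skipped-simulates (skip {j = suc j} s h k) (mergeʳ st) =
  _ , gmap _ mergeʳ (drop-▷e (suc j) s st)
    , skip (▷e-pres-Simple s st) h (subst (suc j ≤_) (sym (▷e-pres-len s st)) k)
Skipped-simulates (under same) st = _ , return st , same
Skipped-simulates (under r) m3 = _ , return m3 , r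
Skipped-simulates (under r) (mergeˡ st) = _ , return (mergeˡ st) , under r
Skipped-simulates (under r) (mergeʳ st) with Skipped-simulates r st
... | _ , steps , r' = _ , gmap _ mergeʳ steps , under r'

Skipped-reaches-simple : ∀ {C} → Skipped X Y → Simple C → X ▷e* C → Y ▷e* C
Skipped-reaches-simple same      _  ε = ε
Skipped-reaches-simple (skip _ _ _) () ε
Skipped-reaches-simple (under _) () ε
Skipped-reaches-simple r sC (st ◅ rest) with Skipped-simulates r st
... | _ , steps , r' = steps ◅◅ Skipped-reaches-simple r' sC rest

lemma3p7 : (e₁ : Env) (nl₁ ol₁ : ℕ) (t₂ : Term) (n₂ : ℕ) (e₂' : Env) (nl₂ ol₃ : ℕ) (e₃ : Env)
    → WFe (merge e₁ nl₁ ol₁ (merge (cons t₂ n₂ e₂') nl₂ ol₃ e₃))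
    → Simple e₃
    → (i : ℕ) → 1 ≤ i → i ≤ nl₂ ∸ n₂ → i ≤ ol₃
    → (C : Env) → Simple C
    → merge e₁ nl₁ ol₁ (merge (cons t₂ n₂ e₂') nl₂ ol₃ e₃) ▷e* C
    → merge e₁ nl₁ ol₁ (merge (cons t₂ n₂ e₂') (nl₂ ∸ i) (ol₃ ∸ i) (drop i e₃)) ▷e* C
lemma3p7 e₁ nl₁ ol₁ t₂ n₂ e₂' nl₂ ol₃ e₃ (_ , (_ , _ , _ , len-e₃) , _) s₃ i _ i≤nl₂-n₂ i≤ol₃ C sC =
  Skipped-reaches-simple (under (skip s₃ i≤nl₂-n₂ i≤len-e₃)) sC
  where
    i≤len-e₃ : i ≤ len e₃
    i≤len-e₃ = subst (i ≤_) (sym len-e₃) i≤ol₃
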